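{- Let $\mathbb{T}$ be a $D$-algebraic theory, $\Omega$ an order bound system of $\mathbb{T}$, $f:(P,i)\to(Q,j)$ a morphism of $\mathbf{DCPO}(\mathbb{T},\Omega)$ and $S$ a subset of $P$. Then $f$ maps $cl^{(\mathbb{T},\Omega)}_{(P,i)}(S)$ into $cl^{(\mathbb{T},\Omega)}_{(Q,j)}(f(S))$, and the resulting restriction and co-restriction $f:cl^{(\mathbb{T},\Omega)}_{(P,i)}(S)\to cl^{(\mathbb{T},\Omega)}_{(Q,j)}(f(S))$ is a morphism of $\mathbf{DCPO}(\mathbb{T},\Omega)$ (where both closures carry the order and operations induced from $(P,i)$ and $(Q,j)$ respectively).
   Context: A $D$-algebraic theory is a tuple $\mathbb{T}=(\Sigma_0,\Sigma_1,\lvert\cdot\rvert,M,\theta,\Lambda)$: disjoint sets $\Sigma_0,\Sigma_1$ of operator symbols, arities $\lvert\cdot\rvert:\Sigma_0\cup\Sigma_1\to\mathbb{N}$, a set $M$ of dcpos, a map $\theta$ assigning to each $(g,k)$ with $g\in\Sigma_1$, $1\le k\le\lvert g\rvert$, an element of $M$ or the symbol $*$, and a set $\Lambda$ of laws $e_1\sqsubseteq e_2$ or $e_1=e_2$ between terms. An order bound system $\Omega$ assigns to each $f\in\Sigma_0$ a functor $\Omega^f:\mathbf{POS}\to\mathbf{SET}$ with $\Omega^fP\subseteq P^{\lvert f\rvert}$, $h^{\lvert f\rvert}(\Omega^fP)\subseteq\Omega^fQ$ for order-preserving $h:P\to Q$, and $\Omega^fh$ the restriction/co-restriction of $h^{\lvert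 f\rvert}$. Objects of $\mathbf{DCPO}(\mathbb{T},\Omega)$ are pairs $(L,i)$: a dcpo $L$, for each $f\in\Sigma_0$ a partially Scott continuous map $i(f):\Omega^fL\to L$ (commuting with sups of directed subsets of $\Omega^fL$ whose sup lies in $\Omega^fL$), for each $g\in\Sigma_1$ a Scott continuous map $i(g):A_{g,1}\times\cdots\times A_{g,\lvert g\rvert}\to L$ with $A_{g,k}=\theta(g,k)$ if $\theta(g,k)\in M$ and $A_{g,k}=L$ if $\theta(g,k)=*$, such that every equation or inequation deducible from $\Lambda$ and monotonicity holds whenever each occurrence of each $i(f)$ is applied to a tuple in $\Omega^fL$. Morphisms $h:(X,i)\to(Y,j)$ are Scott continuous maps with $h(i(f)(x_1,\dots,x_n))=j(f)(h(x_1),\dots,h(x_n))$ for all $f\in\Sigma_0$, $(x_1,\dots,x_n)\in\Omega^fX$, and which preserve each $i(g)$, $g\in\Sigma_1$ (applying $h$ to coordinates with $\theta(g,k)=*$ and the identity to the others). A sub o.b.d.algebra of $(L,i)$ is a subset $S'$ closed under sups of its directed subsets with $i(f)(\Omega^fS')\subseteq S'$ ($S'$ with induced order) for $f\in\Sigma_0$ and $i(g)(E_g(S'))\subseteq S'$ for $g\in\Sigma_1$, where $E_g(S')$ restricts the $*$-coordinates to $S'$; with the induced operations it is again an object of $\mathbf{DCPO}(\mathbb{T},\Omega)$. $cl^{(\mathbb{T},\Omega)}_{(L,i)}(S)$ denotes the smallest sub o.b.d.algebra of $(L,i)$ containing $S$. -}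

module Defs where

open import Level using (Level; _⊔_; suc; 0ℓ; Setω)
open import Data.Nat using (ℕ)
open import Data.Fin using (Fin)
open import Data.Maybe using (Maybe; just; nothing)
open import Data.Product using (Σ; _×_; _,_; proj₁; proj₂; ∃)
open import Relation.Binary.PropositionalEquality
  using (_≡_; refl; isEquivalence; cong)
open import Relation.Binary.Structures using (IsPartialOrder; IsPreorder)
open import Relation.Unary using (Pred; _⊆_)
open import Function using (_∘_)
open import Data.Unit using (⊤; tt)

record Pos (c r : Level) : Set (suc (c ⊔ r)) where
  field
    Carrier        : Set c
    _≤_            : Carrier → Carrier → Set r
    isPartialOrder : IsPartialOrder _≡_ _≤_

Monotone : ∀ {c r c' r'} (P : Pos c r) (Q : Pos c' r') →
           (Pos.Carrier P → Pos.Carrier Q) → Set (c ⊔ r ⊔ r')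
Monotone P Q h = ∀ {x y} → Pos._≤_ P x y → Pos._≤_ Q (h x) (h y)

Directed : ∀ {c r i} {C : Set c} (R : C → C → Set r) {I : Set i} →
           (I → C) → Set (r ⊔ i)
Directed R {I} x = I × (∀ i j → Σ I λ k → R (x i) (x k) × R (x j) (x k))

IsUpper : ∀ {c r i} {C : Set c} (R : C → C → Set r) {I : Set i} →
          (I → C) → C → Set (r ⊔ i)
IsUpper R x u = ∀ i → R (x i) u

IsLub : ∀ {c r i} {C : Set c} (R : C → C → Set r) {I : Set i} →
        (I → C) → C → Set (c ⊔ r ⊔ i)
IsLub R x u = IsUpper R x u × (∀ v → IsUpper R x v → R u v)

ScottContinuous : ∀ ℓ {a r b s} {A : Set a} {B : Set b}
                  (R : A → A → Set r) (S : B → B → Set s) →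
                  (A → B) → Set (a ⊔ r ⊔ s ⊔ b ⊔ Level.suc ℓ)
ScottContinuous ℓ {A = A} R S h =
  ∀ {I : Set ℓ} (x : I → A) → Directed R x → ∀ u → IsLub R x u →
  IsLub S (h ∘ x) (h u)

record IsDCPO {c ℓ} (P : Pos c ℓ) : Set (c ⊔ suc ℓ) where
  open Pos P
  field
    ⋁     : {I : Set ℓ} (x : I → Carrier) → Directed _≤_ x → Carrier
    ⋁-lub : {I : Set ℓ} (x : I → Carrier) (d : Directed _≤_ x) →
            IsLub _≤_ x (⋁ x d)

record DCPO (c ℓ : Level) : Set (suc (c ⊔ ℓ)) where
  field
    pos    : Pos c ℓ
    isDCPO : IsDCPO pos
  open Pos pos public
  open IsDCPO isDCPO public

Pointwise : ∀ {c r n} {C : Set c} (R : C → C → Set r) →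
            (Fin n → C) → (Fin n → C) → Set r
Pointwise R xs ys = ∀ k → R (xs k) (ys k)

-- Subsets as posets with the induced order.  Membership is an
-- irrelevant field, so elements of a subset are determined by their
-- underlying value (a subset is a set of elements, not a family).

record Sub {c k} (C : Set c) (S : Pred C k) : Set (c ⊔ k) where
  constructor ⟨_,_⟩
  field
    val  : C
    .mem : S val
open Sub public

sub-≡ : ∀ {c k} {C : Set c} {S : Pred C k} {x y : Sub C S} →
        val x ≡ val y → x ≡ y
sub-≡ {x = ⟨ v , _ ⟩} {y = ⟨ .v , _ ⟩} refl = refl

subMap : ∀ {c d k k'} {C : Set c} {D : Set d} {S : Pred C k} {S' : Pred D k'}
         (h : C → D) → (∀ x → S x → S' (h x)) → Sub C S → Sub D S'
subMap h maps ⟨ v , m ⟩ = ⟨ h v , maps v m ⟩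

subPos : ∀ {c r k} (P : Pos c r) (S : Pred (Pos.Carrier P) k) → Pos (c ⊔ k) r
subPos P S = record
  { Carrier = Sub (Pos.Carrier P) S
  ; _≤_ = λ x y → Pos._≤_ P (val x) (val y)
  ; isPartialOrder = record
    { isPreorder = record
      { isEquivalence = isEquivalence
      ; reflexive = λ { refl → IsPartialOrder.refl (Pos.isPartialOrder P) }
      ; trans = IsPartialOrder.trans (Pos.isPartialOrder P)
      }
    ; antisym = λ p q → sub-≡ (IsPartialOrder.antisym (Pos.isPartialOrder P) p q)
    }
  }

record Signature (a ℓ : Level) : Set (suc (a ⊔ ℓ)) where
  field
    Σ₀ Σ₁ : Set               -- operator symbols (disjoint: distinct types)
    ar₀   : Σ₀ → ℕ
    ar₁   : Σ₁ → ℕ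
    MI    : Set               -- index set of the set M of dcpos
    M     : MI → DCPO a ℓ
    θ     : (g : Σ₁) → Fin (ar₁ g) → Maybe MI   -- nothing = *

module _ {a ℓ} (Sg : Signature a ℓ) where
  open Signature Sg

  -- the set A_{g,k} : L if θ(g,k) = *, M m if θ(g,k) = m
  data Arg {c} (C : Set c) : Maybe MI → Set (a ⊔ c) where
    star : C → Arg C nothing
    par  : ∀ {m} → DCPO.Carrier (M m) → Arg C (just m)

  mapArg : ∀ {c d} {C : Set c} {D : Set d} {t} → (C → D) → Arg C t → Arg D t
  mapArg h (star x) = star (h x)
  mapArg h (par y)  = par y

  ArgIn : ∀ {c k} {C : Set c} (S : Pred C k) {t} → Arg C t → Set k
  ArgIn S (star x) = S x
  ArgIn {k = k} S (par y)  = Level.Lift k ⊤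

  ArgLe : ∀ {c} {C : Set c} (R : C → C → Set ℓ) {t} → Arg C t → Arg C t → Set ℓ
  ArgLe R (star x) (star y) = R x y
  ArgLe R (par {m} x) (par y) = DCPO._≤_ (M m) x y

  -- Terms: variables of the algebra sort are ℕ; arguments of g in a
  -- position with θ(g,k) = m ∈ M are parameter terms (variables of sort
  -- m, indexed by ℕ, or constants of M m).

  data PTerm (m : MI) : Set a where
    pvar   : ℕ → PTerm m
    pconst : DCPO.Carrier (M m) → PTerm m

  data Term : Set a
  data ArgTerm : Maybe MI → Set a
  data Term where
    var  : ℕ → Term
    app₀ : (f : Σ₀) → (Fin (ar₀ f) → Term) → Term
    app₁ : (g : Σ₁) → ((k : Fin (ar₁ g)) → ArgTerm (θ g k)) → Term
  data ArgTerm where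
    tstar : Term → ArgTerm nothing
    tpar  : ∀ {m} → PTerm m → ArgTerm (just m)

  psubst : ((m : MI) → ℕ → PTerm m) → ∀ {m} → PTerm m → PTerm m
  psubst σP {m} (pvar n) = σP m n
  psubst σP (pconst x)   = pconst x

  subst  : (ℕ → Term) → ((m : MI) → ℕ → PTerm m) → Term → Term
  substA : (ℕ → Term) → ((m : MI) → ℕ → PTerm m) → ∀ {t} → ArgTerm t → ArgTerm t
  subst σ σP (var n)      = σ n
  subst σ σP (app₀ f ts)  = app₀ f (λ k → subst σ σP (ts k))
  subst σ σP (app₁ g as)  = app₁ g (λ k → substA σ σP (as k))
  substA σ σP (tstar e)   = tstar (subst σ σP e)
  substA σ σP (tpar p)    = tpar (psubst σP p)

  data Law : Set a where
    _≼_ : Term → Term → Law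
    _≐_ : Term → Term → Law

record Theory (a ℓ : Level) : Set (suc (a ⊔ ℓ)) where
  field
    sig    : Signature a ℓ
    LawIx  : Set
    Λ      : LawIx → Law sig
  open Signature sig public

-- Deducibility from Λ and monotonicity.  Equations e₁ = e₂ are deduced
-- as the pair e₁ ⊑ e₂, e₂ ⊑ e₁.

module _ {a ℓ} (T : Theory a ℓ) where
  open Theory T

  data Der : Term sig → Term sig → Set (a ⊔ ℓ)
  data DerA : ∀ {t} → ArgTerm sig t → ArgTerm sig t → Set (a ⊔ ℓ)
  data Der where
    ax-≼  : ∀ i e₁ e₂ → Λ i ≡ (e₁ ≼ e₂) → Der e₁ e₂
    ax-≐₁ : ∀ i e₁ e₂ → Λ i ≡ (e₁ ≐ e₂) → Der e₁ e₂
    ax-≐₂ : ∀ i e₁ e₂ → Λ i ≡ (e₁ ≐ e₂) → Der e₂ e₁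
    ⊑-refl  : ∀ e → Der e e
    ⊑-trans : ∀ {e₁ e₂ e₃} → Der e₁ e₂ → Der e₂ e₃ → Der e₁ e₃
    ⊑-subst : ∀ σ σP {e₁ e₂} → Der e₁ e₂ →
              Der (subst sig σ σP e₁) (subst sig σ σP e₂)
    mono₀ : ∀ f (ts ts' : Fin (ar₀ f) → Term sig) →
            (∀ k → Der (ts k) (ts' k)) → Der (app₀ f ts) (app₀ f ts')
    mono₁ : ∀ g (as as' : (k : Fin (ar₁ g)) → ArgTerm sig (θ g k)) →
            (∀ k → DerA (as k) (as' k)) → Der (app₁ g as) (app₁ g as')
  data DerA where
    a-star  : ∀ {e e'} → Der e e' → DerA (tstar e) (tstar e')
    a-refl  : ∀ {m} (p : PTerm sig m) → DerA (tpar p) (tpar p)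
    a-const : ∀ {m} {x y : DCPO.Carrier (M m)} → DCPO._≤_ (M m) x y →
              DerA (tpar (pconst x)) (tpar (pconst y))

_⊢_⊑_ : ∀ {a ℓ} (T : Theory a ℓ) → Term (Theory.sig T) → Term (Theory.sig T) → Set (a ⊔ ℓ)
T ⊢ e₁ ⊑ e₂ = Der T e₁ e₂

record OBS {a ℓ} (Sg : Signature a ℓ) : Setω where
  open Signature Sg
  field
    Ω     : (f : Σ₀) → ∀ {c r} (P : Pos c r) →
            Pred (Fin (ar₀ f) → Pos.Carrier P) (c ⊔ r)
    Ω-map : (f : Σ₀) → ∀ {c r c' r'} {P : Pos c r} {Q : Pos c' r'}
            (h : Pos.Carrier P → Pos.Carrier Q) → Monotone P Q h →
            ∀ xs → Ω f P xs → Ω f Q (h ∘ xs)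

module _ {a ℓ} (T : Theory a ℓ) (Ob : OBS (Theory.sig T)) where
  open Theory T
  open OBS Ob

  record RawAlg (c : Level) : Set (suc (c ⊔ ℓ) ⊔ a) where
    field
      pos : Pos c ℓ
    open Pos pos
    field
      op₀ : (f : Σ₀) (xs : Fin (ar₀ f) → Carrier) → .(Ω f pos xs) → Carrier
      op₁ : (g : Σ₁) → ((k : Fin (ar₁ g)) → Arg sig Carrier (θ g k)) → Carrier

  module _ {c} (A : RawAlg c) where
    open RawAlg A
    open Pos pos

    -- evaluation of terms; app₀ is only evaluated on tuples in Ω^f L
    module _ (ρ : ℕ → Carrier) (π : (m : MI) → ℕ → DCPO.Carrier (M m)) where
      data Eval : Term sig → Carrier → Set (a ⊔ c ⊔ ℓ)
      data EvalA : ∀ {t} → ArgTerm sig t → Arg sig Carrier t → Set (a ⊔ c ⊔ ℓ)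
      data Eval where
        evar : ∀ n → Eval (var n) (ρ n)
        eapp₀ : ∀ f (ts : Fin (ar₀ f) → Term sig) (vs : Fin (ar₀ f) → Carrier) →
                (∀ k → Eval (ts k) (vs k)) → (w : Ω f pos vs) →
                Eval (app₀ f ts) (op₀ f vs w)
        eapp₁ : ∀ g (as : (k : Fin (ar₁ g)) → ArgTerm sig (θ g k))
                (vs : (k : Fin (ar₁ g)) → Arg sig Carrier (θ g k)) →
                (∀ k → EvalA (as k) (vs k)) → Eval (app₁ g as) (op₁ g vs)
      data EvalA where
        estar   : ∀ {e v} → Eval e v → EvalA (tstar e) (star v)
        epvar   : ∀ {m} n → EvalA (tpar {m = m} (pvar n)) (par (π m n))
        epconst : ∀ {m} (x : DCPO.Carrier (M m)) → EvalA (tpar (pconst x)) (par x)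

    Sound : Set (a ⊔ c ⊔ ℓ)
    Sound = ∀ e₁ e₂ → T ⊢ e₁ ⊑ e₂ →
            ∀ ρ π v₁ v₂ → Eval ρ π e₁ v₁ → Eval ρ π e₂ v₂ → v₁ ≤ v₂

  record Alg (c : Level) : Set (suc (a ⊔ c ⊔ ℓ)) where
    field
      raw    : RawAlg c
    open RawAlg raw public
    open Pos pos public
    field
      isDCPO : IsDCPO pos
      op₀-cont : ∀ f {I : Set ℓ} (x : I → (Fin (ar₀ f) → Carrier))
                 (xΩ : ∀ i → Ω f pos (x i)) → Directed (Pointwise _≤_) x →
                 ∀ u → IsLub (Pointwise _≤_) x u → (uΩ : Ω f pos u) →
                 IsLub _≤_ (λ i → op₀ f (x i) (xΩ i)) (op₀ f u uΩ)
      op₁-cont : ∀ g → ScottContinuous ℓ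
                   (λ (xs ys : (k : Fin (ar₁ g)) → Arg sig Carrier (θ g k)) →
                      ∀ k → ArgLe sig _≤_ (xs k) (ys k))
                   _≤_ (op₁ g)
      sound  : Sound raw
    open IsDCPO isDCPO public

  record IsHom {c d} (A : RawAlg c) (B : RawAlg d)
               (h : Pos.Carrier (RawAlg.pos A) → Pos.Carrier (RawAlg.pos B))
               : Set (a ⊔ c ⊔ d ⊔ suc ℓ) where
    module A = RawAlg A
    module B = RawAlg B
    field
      cont : ScottContinuous ℓ (Pos._≤_ A.pos) (Pos._≤_ B.pos) h
      pres₀ : ∀ f xs (w : Ω f A.pos xs) (w' : Ω f B.pos (h ∘ xs)) →
              h (A.op₀ f xs w) ≡ B.op₀ f (h ∘ xs) w'
      pres₁ : ∀ g args → h (A.op₁ g args) ≡ B.op₁ g (λ k → mapArg sig h (args k))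

  module _ {c} (A : Alg c) where
    open Alg A

    record IsSub {k} (S' : Pred Carrier k) : Set (a ⊔ c ⊔ k ⊔ suc ℓ) where
      field
        sub-⋁  : ∀ {I : Set ℓ} (x : I → Sub Carrier S')
                 (d : Directed (Pos._≤_ (subPos pos S')) x) → S' (⋁ (val ∘ x) d)
        sub-op₀ : ∀ f (xs : Fin (ar₀ f) → Sub Carrier S')
                  (w : Ω f (subPos pos S') xs) →
                  S' (op₀ f (val ∘ xs) (Ω-map f {P = subPos pos S'} {Q = pos} val (λ p → p) xs w))
        -- E_g(S'): the *-coordinates restricted to S'
        sub-op₁ : ∀ g (args : (i : Fin (ar₁ g)) → Arg sig (Sub Carrier S') (θ g i))
                  (vs : (i : Fin (ar₁ g)) → Arg sig Carrier (θ g i)) →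
                  (∀ i → mapArg sig val (args i) ≡ vs i) → S' (op₁ g vs)

    cl : ∀ k {s} → Pred Carrier s → Pred Carrier (a ⊔ c ⊔ suc k ⊔ s ⊔ suc ℓ)
    cl k S x = ∀ (S' : Pred Carrier k) → IsSub S' → S ⊆ S' → S' x

    private
      incl : ∀ {k s} {S : Pred Carrier s} (S' : Pred Carrier k) → IsSub S' → S ⊆ S' →
             Sub Carrier (cl k S) → Sub Carrier S'
      incl S' isS S⊆ ⟨ v , m ⟩ = ⟨ v , m S' isS S⊆ ⟩

      argEq : ∀ {k s} {S : Pred Carrier s} (S' : Pred Carrier k) (isS : IsSub S')
              (S⊆ : S ⊆ S') {t} (x : Arg sig (Sub Carrier (cl k S)) t) →
              mapArg sig val (mapArg sig (incl S' isS S⊆) x) ≡ mapArg sig val x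
      argEq S' isS S⊆ (star x) = refl
      argEq S' isS S⊆ (par y)  = refl

      clop₀ : ∀ k {s} (S : Pred Carrier s) f (xs : Fin (ar₀ f) → Sub Carrier (cl k S)) →
              .(Ω f (subPos pos (cl k S)) xs) → Sub Carrier (cl k S)
      clop₀ k S f xs w = ⟨ op₀ f (val ∘ xs) (Ω-map f {P = subPos pos (cl k S)} {Q = pos} val (λ p → p) xs w)
                         , (λ S' isS S⊆ → IsSub.sub-op₀ isS f (incl S' isS S⊆ ∘ xs)
                              (Ω-map f (incl S' isS S⊆) (λ p → p) xs w)) ⟩

      clop₁ : ∀ k {s} (S : Pred Carrier s) g
              (args : (i : Fin (ar₁ g)) → Arg sig (Sub Carrier (cl k S)) (θ g i)) →
              Sub Carrier (cl k S)
      clop₁ k S g args = ⟨ op₁ g (λ i → mapArg sig val (args i))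
                         , (λ S' isS S⊆ → IsSub.sub-op₁ isS g
                              (λ i → mapArg sig (incl S' isS S⊆) (args i))
                              (λ i → mapArg sig val (args i))
                              (λ i → argEq S' isS S⊆ (args i))) ⟩

    clRaw : ∀ k {s} → Pred Carrier s → RawAlg (a ⊔ c ⊔ suc k ⊔ s ⊔ suc ℓ)
    clRaw k S = record
      { pos = subPos pos (cl k S)
      ; op₀ = clop₀ k S
      ; op₁ = clop₁ k S
      }

image : ∀ {c d s} {C : Set c} {D : Set d} → (C → D) → Pred C s → Pred D (c ⊔ d ⊔ s)
image h S y = ∃ λ x → S x × h x ≡ y

-- A morphism f pulls sub o.b.d.algebras back to sub o.b.d.algebras, so the preimage of
-- cl(f S) is a sub o.b.d.algebra containing S and hence contains cl(S). The restriction
-- of f to the closures preserves the induced operations because f does, and it is Scott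
-- continuous because a closure is closed under directed sups, so lubs computed in the
-- closure are lubs in the ambient dcpo, where f preserves them.
module Submission where

open import Defs hiding (subst)
open import Level using (Level; Lift; lift; _⊔_) renaming (suc to lsuc)
open import Data.Bool using (Bool; true; false)
open import Data.Fin using (Fin)
open import Data.Product using (Σ; _,_; proj₁; proj₂)
open import Function using (_∘_)
open import Relation.Binary.Definitions using (Antisymmetric; Reflexive)
open import Relation.Binary.PropositionalEquality
  using (_≡_; refl; sym; trans; subst)
open import Relation.Binary.Structures using (IsPartialOrder)
open import Relation.Unary using (Pred)

ScottContinuous⇒Monotone : ∀ {ℓ a r b s} {A : Set a} {B : Set b}
  {R : A → A → Set r} {R' : B → B → Set s} {h : A → B} →
  Reflexive R → ScottContinuous ℓ R R' h → ∀ {x y} → R x y → R' (h x) (h y)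
ScottContinuous⇒Monotone {ℓ} {A = A} {R = R} R-refl cont {x} {y} x≤y =
  proj₁ (cont pair pair-directed y pair-lub) (lift false)
  where
  pair : Lift ℓ Bool → A
  pair (lift false) = x
  pair (lift true)  = y

  pair≤y : IsUpper R pair y
  pair≤y (lift false) = x≤y
  pair≤y (lift true)  = R-refl

  pair-directed : Directed R pair
  pair-directed = lift true , λ i j → lift true , pair≤y i , pair≤y j

  pair-lub : IsLub R pair y
  pair-lub = pair≤y , λ v v-upper → v-upper (lift true)

IsLub-unique : ∀ {c r i} {C : Set c} {R : C → C → Set r} {I : Set i} {x : I → C} {u v : C} →
  Antisymmetric _≡_ R → IsLub R x u → IsLub R x v → u ≡ v
IsLub-unique antisym (u-upper , u-least) (v-upper , v-least) =
  antisym (u-least _ v-upper) (v-least _ u-upper)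

Directed-map : ∀ {c d r s i} {C : Set c} {D : Set d}
  {R : C → C → Set r} {R' : D → D → Set s} {h : C → D} {I : Set i} {x : I → C} →
  (∀ {y z} → R y z → R' (h y) (h z)) → Directed R x → Directed R' (h ∘ x)
Directed-map mono (i , bound) = i , λ j k →
  let (l , j≤l , k≤l) = bound j k in l , mono j≤l , mono k≤l

IsLub-sub : ∀ {c r i k} {C : Set c} {R : C → C → Set r} {S : Pred C k}
  {I : Set i} {x : I → Sub C S} {u : Sub C S} →
  IsLub R (val ∘ x) (val u) → IsLub (λ y z → R (val y) (val z)) x u
IsLub-sub (u-upper , u-least) = u-upper , λ v → u-least (val v)

mapArg-∘ : ∀ {a ℓ c d e} (Sg : Signature a ℓ) {C : Set c} {D : Set d} {E : Set e} {t}
  (g : D → E) (h : C → D) (x : Arg Sg C t) →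
  mapArg Sg g (mapArg Sg h x) ≡ mapArg Sg (g ∘ h) x
mapArg-∘ Sg g h (star x) = refl
mapArg-∘ Sg g h (par y)  = refl

module _ {a ℓ} (T : Theory a ℓ) (Ob : OBS (Theory.sig T)) where
  open Theory T
  open OBS Ob

  module _ {c} (A : Alg T Ob c) where
    open Alg A
    open IsPartialOrder isPartialOrder using (antisym) renaming (refl to ≤-refl; trans to ≤-trans)

    DirectedClosed : ∀ {k} → Pred Carrier k → Set (lsuc ℓ ⊔ c ⊔ k)
    DirectedClosed S' = ∀ {I : Set ℓ} (x : I → Sub Carrier S')
      (d : Directed _≤_ (val ∘ x)) → S' (⋁ (val ∘ x) d)

    ArgLe-refl : ∀ {t} (x : Arg sig Carrier t) → ArgLe sig _≤_ x x
    ArgLe-refl (star x)    = ≤-refl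
    ArgLe-refl (par {m} y) = IsPartialOrder.refl (DCPO.isPartialOrder (M m))

    op₁-cong : ∀ g {xs ys : (i : Fin (ar₁ g)) → Arg sig Carrier (θ g i)} →
      (∀ i → xs i ≡ ys i) → op₁ g xs ≡ op₁ g ys
    op₁-cong g xs≡ys = antisym (op₁-mono (≡⇒ArgLe ∘ xs≡ys)) (op₁-mono (≡⇒ArgLe ∘ sym ∘ xs≡ys))
      where
      ≡⇒ArgLe : ∀ {t} {x y : Arg sig Carrier t} → x ≡ y → ArgLe sig _≤_ x y
      ≡⇒ArgLe {x = x} refl = ArgLe-refl x

      op₁-mono : ∀ {xs ys : (i : Fin (ar₁ g)) → Arg sig Carrier (θ g i)} →
        (∀ i → ArgLe sig _≤_ (xs i) (ys i)) → op₁ g xs ≤ op₁ g ys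
      op₁-mono = ScottContinuous⇒Monotone {R' = _≤_} {h = op₁ g}
        (λ {xs} i → ArgLe-refl (xs i)) (op₁-cont g)

    -- A lub in the induced order is bounded by the ambient sup, which lies in the subset.
    IsLub-val : ∀ {k} {S' : Pred Carrier k} → DirectedClosed S' →
      ∀ {I : Set ℓ} {x : I → Sub Carrier S'} {u : Sub Carrier S'} → Directed _≤_ (val ∘ x) →
      IsLub (Pos._≤_ (subPos pos S')) x u → IsLub _≤_ (val ∘ x) (val u)
    IsLub-val closed {x = x} d (u-upper , u-least) =
      u-upper , λ v v-upper → ≤-trans (u-least ⟨ sup , closed x d ⟩ sup-upper) (sup-least v v-upper)
      where
      sup : Carrier
      sup = ⋁ (val ∘ x) d

      sup-upper : IsUpper _≤_ (val ∘ x) sup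
      sup-upper = proj₁ (⋁-lub (val ∘ x) d)

      sup-least : ∀ v → IsUpper _≤_ (val ∘ x) v → sup ≤ v
      sup-least = proj₂ (⋁-lub (val ∘ x) d)

    cl-DirectedClosed : ∀ k {s} (S : Pred Carrier s) → DirectedClosed (cl T Ob A k S)
    cl-DirectedClosed k S x d S' S'-sub S⊆S' =
      IsSub.sub-⋁ S'-sub (subMap (λ y → y) (λ y y∈cl → y∈cl S' S'-sub S⊆S') ∘ x) d

  module _ {c d} (P : Alg T Ob c) (Q : Alg T Ob d)
           (f : Alg.Carrier P → Alg.Carrier Q) (hom : IsHom T Ob (Alg.raw P) (Alg.raw Q) f) where
    private
      module P = Alg P
      module Q = Alg Q
      module H = IsHom hom

    hom-mono : ∀ {x y} → x P.≤ y → f x Q.≤ f y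
    hom-mono = ScottContinuous⇒Monotone {R' = Q._≤_} {h = f} (IsPartialOrder.refl P.isPartialOrder) H.cont

    hom-⋁ : ∀ {I : Set ℓ} (x : I → P.Carrier) (d : Directed P._≤_ x) →
      f (P.⋁ x d) ≡ Q.⋁ (f ∘ x) (Directed-map {R' = Q._≤_} {h = f} hom-mono d)
    hom-⋁ x d = IsLub-unique (IsPartialOrder.antisym Q.isPartialOrder)
      (H.cont x d _ (P.⋁-lub x d)) (Q.⋁-lub (f ∘ x) _)

    preimage-IsSub : ∀ {k} {S' : Pred Q.Carrier k} → IsSub T Ob Q S' → IsSub T Ob P (S' ∘ f)
    preimage-IsSub {S' = S'} S'-sub = record
      { sub-⋁   = λ x d → subst S' (sym (hom-⋁ (val ∘ x) d))
                    (IsSub.sub-⋁ S'-sub (restrict ∘ x) (Directed-map {R' = Q._≤_} {h = f} hom-mono d))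
      ; sub-op₀ = λ g xs w → subst S'
                    (sym (H.pres₀ g (val ∘ xs) (Ω-map g val (λ p → p) xs w) (Ω-map g (f ∘ val) hom-mono xs w)))
                    (IsSub.sub-op₀ S'-sub g (restrict ∘ xs) (Ω-map g restrict hom-mono xs w))
      ; sub-op₁ = λ g args vs args≡vs → subst S' (sym (H.pres₁ g vs))
                    (IsSub.sub-op₁ S'-sub g (mapArg sig restrict ∘ args) (mapArg sig f ∘ vs)
                      (λ i → restrict-arg (args i) (args≡vs i)))
      }
      where
      restrict : Sub P.Carrier (S' ∘ f) → Sub Q.Carrier S'
      restrict = subMap f (λ _ fx∈S' → fx∈S')

      restrict-arg : ∀ {t} (x : Arg sig (Sub P.Carrier (S' ∘ f)) t) {v : Arg sig P.Carrier t} →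
        mapArg sig val x ≡ v → mapArg sig val (mapArg sig restrict x) ≡ mapArg sig f v
      restrict-arg x refl =
        trans (mapArg-∘ sig val restrict x) (sym (mapArg-∘ sig f val x))

    cl-image : ∀ k {s} (S : Pred P.Carrier s) x →
      cl T Ob P k S x → cl T Ob Q k (image f S) (f x)
    cl-image k S x x∈cl S' S'-sub fS⊆S' =
      x∈cl (S' ∘ f) (preimage-IsSub S'-sub) (λ y∈S → fS⊆S' (_ , y∈S , refl))

    cl-restriction-IsHom : ∀ k {s} (S : Pred P.Carrier s) →
      IsHom T Ob (clRaw T Ob P k S) (clRaw T Ob Q k (image f S)) (subMap f (cl-image k S))
    cl-restriction-IsHom k S = record
      { cont  = λ x d u u-lub → IsLub-sub {R = Q._≤_} {x = restriction ∘ x} {u = restriction u}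
          (H.cont (val ∘ x) d (val u) (IsLub-val P (cl-DirectedClosed P k S) {x = x} {u = u} d u-lub))
      ; pres₀ = λ g xs w w' → sub-≡
          (H.pres₀ g (val ∘ xs) (Ω-map g val (λ p → p) xs w) (Ω-map g val (λ p → p) _ w'))
      ; pres₁ = λ g args → sub-≡ (trans (H.pres₁ g (λ i → mapArg sig val (args i)))
          (op₁-cong Q g λ i → trans (mapArg-∘ sig f val (args i))
                                    (sym (mapArg-∘ sig val restriction (args i)))))
      }
      where
      restriction : Sub P.Carrier (cl T Ob P k S) → Sub Q.Carrier (cl T Ob Q k (image f S))
      restriction = subMap f (cl-image k S)

lemma3p5 : ∀ {a ℓ c d s k : Level} (T : Theory a ℓ) (Ω : OBS (Theory.sig T))
    (P : Alg T Ω c) (Q : Alg T Ω d)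
    (f : Alg.Carrier P → Alg.Carrier Q) →
    IsHom T Ω (Alg.raw P) (Alg.raw Q) f →
    (S : Pred (Alg.Carrier P) s) →
    Σ (∀ x → cl T Ω P k S x → cl T Ω Q k (image f S) (f x)) λ maps →
    IsHom T Ω (clRaw T Ω P k S) (clRaw T Ω Q k (image f S)) (subMap f maps)
lemma3p5 {k = k} T Ω P Q f hom S =
  cl-image T Ω P Q f hom k S , cl-restriction-IsHom T Ω P Q f hom k S
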